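{- There is an absolute constant $C>0$ such that the following holds. Let $G(V,E)$ be a finite directed graph with $n=|V|$ and two distinguished vertices $s,t \in V$, and let $P$ be a balanced path from $s$ to $t$. Then there exists a balanced path $Q$ from $s$ to $t$ whose length is at most $C n^3$.
   Context: Let $G(V,E)$ be a directed graph and $G'(V,E')$ its underlying undirected graph, in which $u$ and $v$ are adjacent iff $(u,v)\in E$ or $(v,u)\in E$. A path from $s$ to $t$ is a walk in $G'$, i.e. a sequence of vertices $s=v_0,v_1,\dots,v_\ell=t$ with consecutive vertices adjacent in $G'$ (vertices and edges may repeat); its length is $\ell$. A traversed edge $(v_{j-1},v_j)$ of the path is neutral if both $(v_{j-1},v_j)\in E$ and $(v_j,v_{j-1})\in E$; forward if $(v_{j-1},v_j)\in E$ and $(v_j,v_{j-1})\notin E$; backward if $(v_{j-1},v_j)\notin E$ and $(v_j,v_{j-1})\in E$. A path is balanced if the number of forward edges along it (counted with multiplicity) equals the number of backward edges along it; it may contain any number of neutral edges. The bound $O(n^3)$ in the paper is interpreted as $\le Cn^3$ with $C$ independent of the graph. -}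

module Defs where

open import Data.Nat using (ℕ; zero; suc; _+_)
open import Data.Fin using (Fin)
open import Relation.Binary.PropositionalEquality using (_≡_)
open import Data.Bool using (Bool; true; false; _∨_; T)

Digraph : ℕ → Set
Digraph n = Fin n → Fin n → Bool

Adj : ∀ {n} → Digraph n → Fin n → Fin n → Set
Adj E u v = T (E u v ∨ E v u)

data Walk {n : ℕ} (E : Digraph n) : Fin n → Fin n → Set where
  [] : ∀ {v} → Walk E v v
  step : ∀ {u v w} → Adj E u v → Walk E v w → Walk E u w

length : ∀ {n} {E : Digraph n} {s t} → Walk E s t → ℕ
length [] = 0
length (step _ p) = suc (length p)

isForward : Bool → Bool → ℕ
isForward true false = 1
isForward _ _ = 0

forwardCount : ∀ {n} {E : Digraph n} {s t} → Walk E s t → ℕ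
forwardCount [] = 0
forwardCount {E = E} (step {u} {v} _ p) = isForward (E u v) (E v u) + forwardCount p

backwardCount : ∀ {n} {E : Digraph n} {s t} → Walk E s t → ℕ
backwardCount [] = 0
backwardCount {E = E} (step {u} {v} _ p) = isForward (E v u) (E u v) + backwardCount p

Balanced : ∀ {n} {E : Digraph n} {s t} → Walk E s t → Set
Balanced p = forwardCount p ≡ backwardCount p

-- Let f i and g i count the forward and backward edges among the first i
-- steps of a balanced walk of length L, so f 0 = g 0 = 0 = f L - g L and the
-- height f - g moves by at most one per step.  Removing two closed sub-walks
-- on [a, a′] and [b′, b] whose height changes cancel keeps the walk balanced
-- and shortens it.  If the height stays within ±n² then among the L + 1
-- pairs (vertex, height) two coincide once L ≥ n(2n² + 1), and the closed
-- walk between them has height change 0.  Otherwise the height reaches n² + 1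
-- (or −n² − 1) at some m, and for each level k ≤ n² + 1 the first and the
-- last crossing of level k around m give n² + 1 nested pairs of positions;
-- two levels k < k′ share both vertices, and the closed walks from the
-- first k- to the first k′-crossing and from the last k′- to the last
-- k-crossing rise and fall by k′ − k.  Iterating brings the length below 3n³.
module Submission where

open import Defs
open import Data.Nat
  using (ℕ; zero; suc; _+_; _∸_; _≤_; _<_; _*_; _^_; z≤n; s≤s; _≤?_)
open import Data.Nat.Properties
open import Data.Nat.Induction using (<-wellFounded)
open import Data.Nat.Tactic.RingSolver using (solve-∀)
open import Data.Fin using (Fin; toℕ; combine; fromℕ<)
import Data.Fin.Properties as Fin
open import Data.Product using (Σ; _×_; _,_)
open import Data.Sum using (inj₁; inj₂)
open import Data.Bool using (true; false)
open import Relation.Nullary using (¬_; Dec; yes; no)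
open import Relation.Nullary.Negation using (contradiction)
open import Relation.Nullary.Decidable using (_⊎-dec_)
open import Induction.WellFounded using (Acc; acc)
open import Relation.Binary.PropositionalEquality

module BoundedSearch {P : ℕ → Set} (P? : ∀ i → Dec (P i)) where

  least : ∀ {m} → P m → Σ ℕ λ i → P i × i ≤ m × (∀ {j} → j < i → ¬ P j)
  least {m} = search m ≤-refl
    where
    search : ∀ bound {m} → m ≤ bound → P m →
             Σ ℕ λ i → P i × i ≤ m × (∀ {j} → j < i → ¬ P j)
    search zero z≤n P0 = 0 , P0 , z≤n , λ ()
    search (suc bound) {m} m≤ Pm with anyUpTo? P? m
    ... | no none = m , Pm , ≤-refl , λ j<m Pj → none (_ , j<m , Pj)
    ... | yes (i , i<m , Pi) =
      let (i′ , Pi′ , i′≤i , minimal) = search bound (≤-pred (≤-trans i<m m≤)) Pi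
      in  i′ , Pi′ , ≤-trans i′≤i (<⇒≤ i<m) , minimal

  greatest : ∀ L {m} → m ≤ L → P m →
             Σ ℕ λ i → P i × m ≤ i × i ≤ L × (∀ {j} → i < j → j ≤ L → ¬ P j)
  greatest zero z≤n P0 = 0 , P0 , z≤n , z≤n , λ 0<j j≤0 _ → <⇒≱ 0<j j≤0
  greatest (suc L) {m} m≤ Pm with P? (suc L)
  ... | yes PL = suc L , PL , m≤ , ≤-refl , λ L<j j≤L _ → <⇒≱ L<j j≤L
  ... | no ¬PL =
    let (i , Pi , m≤i , i≤L , maximal) = greatest L m≤L Pm
    in  i , Pi , m≤i , m≤n⇒m≤1+n i≤L , beyond maximal
    where
    m≤L : m ≤ L
    m≤L = ≤-pred (≤∧≢⇒< m≤ λ { refl → ¬PL Pm })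
    beyond : ∀ {i} → (∀ {j} → i < j → j ≤ L → ¬ P j) →
             ∀ {j} → i < j → j ≤ suc L → ¬ P j
    beyond maximal i<j j≤ with m≤n⇒m<n∨m≡n j≤
    ... | inj₁ j<  = maximal i<j (≤-pred j<)
    ... | inj₂ refl = ¬PL

record StepCounter (f : ℕ → ℕ) : Set where
  field
    start : f 0 ≡ 0
    mono  : ∀ i → f i ≤ f (suc i)
    unit  : ∀ i → f (suc i) ≤ suc (f i)

Exceeds : (f g : ℕ → ℕ) → ℕ → ℕ → Set
Exceeds f g k i = g i + k ≤ f i

exceeds? : ∀ f g k i → Dec (Exceeds f g k i)
exceeds? f g k i = g i + k ≤? f i

-- cancels says (f − g) a′ − (f − g) a = (f − g) b′ − (f − g) b, without subtraction.
record Shortcut {n : ℕ} (L : ℕ) (V : ℕ → Fin n) (f g : ℕ → ℕ) : Set where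
  field
    a a′ b′ b : ℕ
    a<a′  : a < a′
    a′≤b′ : a′ ≤ b′
    b′≤b  : b′ ≤ b
    b≤L   : b ≤ L
    loop₁ : V a ≡ V a′
    loop₂ : V b′ ≡ V b
    cancels : (f a′ + f b) + (g a + g b′) ≡ (g a′ + g b) + (f a + f b′)

Shortcut-swap : ∀ {n L V f g} → Shortcut {n} L V g f → Shortcut L V f g
Shortcut-swap c = record { Shortcut c hiding (cancels); cancels = sym (Shortcut.cancels c) }

∸-cross : ∀ {x y x′ y′} → y ≤ x → y′ ≤ x′ → x ∸ y ≡ x′ ∸ y′ → x + y′ ≡ x′ + y
∸-cross {x} {y} {x′} {y′} y≤x y′≤x′ eq = begin
  x + y′             ≡⟨ cong (_+ y′) (m∸n+n≡m y≤x) ⟨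
  (x ∸ y) + y + y′   ≡⟨ cong (λ d → d + y + y′) eq ⟩
  (x′ ∸ y′) + y + y′ ≡⟨ swap (x′ ∸ y′) y y′ ⟩
  (x′ ∸ y′) + y′ + y ≡⟨ cong (_+ y) (m∸n+n≡m y′≤x′) ⟩
  x′ + y             ∎
  where
  open ≡-Reasoning
  swap : ∀ d y y′ → d + y + y′ ≡ d + y′ + y
  swap = solve-∀

module _ {n : ℕ} (L : ℕ) (V : ℕ → Fin n) {f g : ℕ → ℕ} where

  shortcut-of-equal-heights : ∀ {i j} → i < j → j ≤ L → V i ≡ V j →
                              f i + g j ≡ f j + g i → Shortcut L V f g
  shortcut-of-equal-heights {i} {j} i<j j≤L Vi≡Vj e = record
    { a = i ; a′ = j ; b′ = j ; b = j
    ; a<a′ = i<j ; a′≤b′ = ≤-refl ; b′≤b = ≤-refl ; b≤L = j≤L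
    ; loop₁ = Vi≡Vj ; loop₂ = refl
    ; cancels = begin
        (f j + f j) + (g i + g j) ≡⟨ regroup (f j) (f j) (g i) (g j) ⟩
        (f j + g i) + (f j + g j) ≡⟨ cong (_+ (f j + g j)) e ⟨
        (f i + g j) + (f j + g j) ≡⟨ regroup′ (f i) (g j) (f j) ⟩
        (g j + g j) + (f i + f j) ∎
    }
    where
    open ≡-Reasoning
    regroup : ∀ a b c d → (a + b) + (c + d) ≡ (a + c) + (b + d)
    regroup = solve-∀
    regroup′ : ∀ a b c → (a + b) + (c + b) ≡ (b + b) + (a + c)
    regroup′ = solve-∀

  shortcut-of-bounded-height :
    (∀ {i} → i ≤ L → f i ≤ g i + n * n) → (∀ {i} → i ≤ L → g i ≤ f i + n * n) →
    n * suc (n * n + n * n) ≤ L → Shortcut L V f g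
  shortcut-of-bounded-height below above long =
    let (x , y , x<y , same) = Fin.pigeonhole (s≤s long) pigeon
    in  shortcut-of-equal-heights x<y (position≤L y)
          (Fin.combine-injectiveˡ _ _ _ _ same)
          (same-height same)
    where
    K = n * n
    level : ℕ → ℕ
    level i = K + f i ∸ g i
    position≤L : (x : Fin (suc L)) → toℕ x ≤ L
    position≤L x = ≤-pred (Fin.toℕ<n x)
    above′ : ∀ {i} → i ≤ L → g i ≤ K + f i
    above′ {i} i≤L = ≤-trans (above i≤L) (≤-reflexive (+-comm (f i) K))
    level< : ∀ {i} → i ≤ L → level i < suc (K + K)
    level< {i} i≤L = s≤s (begin
      K + f i ∸ g i       ≤⟨ ∸-monoˡ-≤ (g i) (+-monoʳ-≤ K (below i≤L)) ⟩
      K + (g i + K) ∸ g i ≡⟨ cong (_∸ g i) (+-comm K (g i + K)) ⟩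
      g i + K + K ∸ g i   ≡⟨ cong (_∸ g i) (+-assoc (g i) K K) ⟩
      g i + (K + K) ∸ g i ≡⟨ m+n∸m≡n (g i) (K + K) ⟩
      K + K               ∎)
      where open ≤-Reasoning
    pigeon : Fin (suc L) → Fin (n * suc (K + K))
    pigeon x = combine (V (toℕ x)) (fromℕ< (level< (position≤L x)))
    same-level : ∀ {x y} → pigeon x ≡ pigeon y → level (toℕ x) ≡ level (toℕ y)
    same-level {x} {y} same = begin
      level (toℕ x)                         ≡⟨ Fin.toℕ-fromℕ< _ ⟨
      toℕ (fromℕ< (level< (position≤L x))) ≡⟨ cong toℕ (Fin.combine-injectiveʳ _ _ (V (toℕ y)) _ same) ⟩
      toℕ (fromℕ< (level< (position≤L y))) ≡⟨ Fin.toℕ-fromℕ< _ ⟩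
      level (toℕ y)                         ∎
      where open ≡-Reasoning
    same-height : ∀ {x y} → pigeon x ≡ pigeon y →
                  f (toℕ x) + g (toℕ y) ≡ f (toℕ y) + g (toℕ x)
    same-height {x} {y} same = +-cancelˡ-≡ K _ _ (begin
      K + (f i + g j) ≡⟨ +-assoc K (f i) (g j) ⟨
      K + f i + g j   ≡⟨ ∸-cross (above′ (position≤L x)) (above′ (position≤L y)) (same-level same) ⟩
      K + f j + g i   ≡⟨ +-assoc K (f j) (g i) ⟩
      K + (f j + g i) ∎)
      where
      open ≡-Reasoning
      i = toℕ x
      j = toℕ y

module _ {n : ℕ} (L : ℕ) (V : ℕ → Fin n) {f g : ℕ → ℕ}
         (f-counter : StepCounter f) (g-counter : StepCounter g) (f≡g-at-L : f L ≡ g L)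
  where

  private
    module F = StepCounter f-counter
    module G = StepCounter g-counter

  exceeds-mono : ∀ {k k′ i} → k ≤ k′ → Exceeds f g k′ i → Exceeds f g k i
  exceeds-mono {i = i} k≤k′ = ≤-trans (+-monoʳ-≤ (g i) k≤k′)

  exact-at-first-crossing : ∀ {k a} → Exceeds f g (suc k) a →
                            (∀ {j} → j < a → ¬ Exceeds f g (suc k) j) → f a ≡ g a + suc k
  exact-at-first-crossing {k} {zero} above _ =
    contradiction (subst₂ _≤_ (cong (_+ suc k) G.start) F.start above) λ ()
  exact-at-first-crossing {k} {suc a} above before = ≤-antisym (begin
    f (suc a)         ≤⟨ F.unit a ⟩
    suc (f a)         ≤⟨ ≰⇒> (before (n<1+n a)) ⟩
    g a + suc k       ≤⟨ +-monoˡ-≤ (suc k) (G.mono a) ⟩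
    g (suc a) + suc k ∎) above
    where open ≤-Reasoning

  exact-at-last-crossing : ∀ {k b} → b ≤ L → Exceeds f g (suc k) b →
                           (∀ {j} → b < j → j ≤ L → ¬ Exceeds f g (suc k) j) →
                           f b ≡ g b + suc k
  exact-at-last-crossing {k} {b} b≤L above after with m≤n⇒m<n∨m≡n b≤L
  ... | inj₂ refl = contradiction (subst (g b + suc k ≤_) f≡g-at-L above) (m+1+n≰m (g b))
  ... | inj₁ b<L = ≤-antisym (≤-pred (begin
    suc (f b)             ≤⟨ s≤s (F.mono b) ⟩
    suc (f (suc b))       ≤⟨ ≰⇒> (after (n<1+n b) b<L) ⟩
    g (suc b) + suc k     ≤⟨ +-monoˡ-≤ (suc k) (G.unit b) ⟩
    suc (g b) + suc k     ∎)) above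
    where open ≤-Reasoning

  record Crossings (k : ℕ) : Set where
    field
      first last    : ℕ
      first≤last    : first ≤ last
      last≤L        : last ≤ L
      first-exact   : f first ≡ g first + k
      last-exact    : f last ≡ g last + k
      before-first  : ∀ {j} → j < first → ¬ Exceeds f g k j
      after-last    : ∀ {j} → last < j → j ≤ L → ¬ Exceeds f g k j

  crossings : ∀ {k m} → m ≤ L → Exceeds f g (suc k) m → Crossings (suc k)
  crossings {k} m≤L above =
    let (a , above-a , a≤m , before) = least above
        (b , above-b , m≤b , b≤L , after) = greatest L m≤L above
    in  record
      { first = a ; last = b ; first≤last = ≤-trans a≤m m≤b ; last≤L = b≤L
      ; first-exact = exact-at-first-crossing above-a before
      ; last-exact = exact-at-last-crossing b≤L above-b after
      ; before-first = before ; after-last = after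
      }
    where open BoundedSearch (exceeds? f g (suc k))

  shortcut-of-nested-crossings : ∀ {k k′} → k < k′ → (c : Crossings k) (c′ : Crossings k′) →
    V (Crossings.first c) ≡ V (Crossings.first c′) → V (Crossings.last c′) ≡ V (Crossings.last c) →
    Shortcut L V f g
  shortcut-of-nested-crossings {k} {k′} k<k′ c c′ loop₁ loop₂ = record
    { a = a ; a′ = a′ ; b′ = b′ ; b = b
    ; a<a′ = ≤∧≢⇒< a≤a′ a≢a′ ; a′≤b′ = C′.first≤last ; b′≤b = b′≤b ; b≤L = C.last≤L
    ; loop₁ = loop₁ ; loop₂ = loop₂
    ; cancels = begin
        (f a′ + f b) + (g a + g b′)
          ≡⟨ cong₂ (λ x y → (x + y) + (g a + g b′)) C′.first-exact C.last-exact ⟩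
        ((g a′ + k′) + (g b + k)) + (g a + g b′)
          ≡⟨ regroup (g a′) (g b) (g a) (g b′) k k′ ⟩
        (g a′ + g b) + ((g a + k) + (g b′ + k′))
          ≡⟨ cong₂ (λ x y → (g a′ + g b) + (x + y)) C.first-exact C′.last-exact ⟨
        (g a′ + g b) + (f a + f b′) ∎
    }
    where
    module C = Crossings c
    module C′ = Crossings c′
    open ≡-Reasoning
    a = C.first
    a′ = C′.first
    b′ = C′.last
    b = C.last
    exceeds-lower : ∀ {i} → f i ≡ g i + k′ → Exceeds f g k i
    exceeds-lower e = exceeds-mono (<⇒≤ k<k′) (≤-reflexive (sym e))
    a≤a′ : a ≤ a′
    a≤a′ = ≮⇒≥ λ a′<a → C.before-first a′<a (exceeds-lower C′.first-exact)
    a≢a′ : a ≢ a′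
    a≢a′ refl = <⇒≢ k<k′ (+-cancelˡ-≡ (g a) k k′ (trans (sym C.first-exact) C′.first-exact))
    b′≤b : b′ ≤ b
    b′≤b = ≮⇒≥ λ b<b′ → C.after-last b<b′ C′.last≤L (exceeds-lower C′.last-exact)
    regroup : ∀ x y z w k k′ → ((x + k′) + (y + k)) + (z + w) ≡ (x + y) + ((z + k) + (w + k′))
    regroup = solve-∀

  shortcut-of-peak : ∀ {m} → m ≤ L → Exceeds f g (suc (n * n)) m → Shortcut L V f g
  shortcut-of-peak {m} m≤L peak =
    let (x , y , x<y , same) = Fin.pigeonhole (n<1+n (n * n)) pigeon
    in  shortcut-of-nested-crossings (s≤s x<y) (level x) (level y)
          (Fin.combine-injectiveˡ (first x) (last x) (first y) (last y) same)
          (sym (Fin.combine-injectiveʳ (first x) (last x) (first y) (last y) same))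
    where
    level : (x : Fin (suc (n * n))) → Crossings (suc (toℕ x))
    level x = crossings m≤L (exceeds-mono (Fin.toℕ<n x) peak)
    first last : Fin (suc (n * n)) → Fin n
    first x = V (Crossings.first (level x))
    last x = V (Crossings.last (level x))
    pigeon : Fin (suc (n * n)) → Fin (n * n)
    pigeon x = combine (first x) (last x)

not-exceeds : ∀ {x y k} → ¬ (y + suc k ≤ x) → x ≤ y + k
not-exceeds {x} {y} {k} ¬exceeds = ≤-pred (subst (suc x ≤_) (+-suc y k) (≰⇒> ¬exceeds))

shortcut-exists : ∀ {n} L (V : ℕ → Fin n) {f g} → StepCounter f → StepCounter g → f L ≡ g L →
                  n * suc (n * n + n * n) ≤ L → Shortcut L V f g
shortcut-exists {n} L V {f} {g} f-counter g-counter f≡g-at-L long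
  with anyUpTo? (λ i → exceeds? f g (suc (n * n)) i ⊎-dec exceeds? g f (suc (n * n)) i) (suc L)
... | yes (m , m<1+L , inj₁ peak) =
  shortcut-of-peak L V f-counter g-counter f≡g-at-L (≤-pred m<1+L) peak
... | yes (m , m<1+L , inj₂ trough) =
  Shortcut-swap (shortcut-of-peak L V g-counter f-counter (sym f≡g-at-L) (≤-pred m<1+L) trough)
... | no bounded = shortcut-of-bounded-height L V
  (λ i≤L → not-exceeds λ peak → bounded (_ , s≤s i≤L , inj₁ peak))
  (λ i≤L → not-exceeds λ trough → bounded (_ , s≤s i≤L , inj₂ trough))
  long

offsets-cancel : ∀ {q q′ w w′ x x′ y y′} → w ≡ w′ → q + x ≡ w + y → q′ + x′ ≡ w′ + y′ →
                 x + y′ ≡ x′ + y → q ≡ q′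
offsets-cancel {q} {q′} {w} {_} {x} {x′} {y} {y′} refl e e′ cross = +-cancelʳ-≡ (x + y′) q q′ (begin
  q + (x + y′)  ≡⟨ +-assoc q x y′ ⟨
  q + x + y′    ≡⟨ cong (_+ y′) e ⟩
  w + y + y′    ≡⟨ +-assoc w y y′ ⟩
  w + (y + y′)  ≡⟨ cong (w +_) (+-comm y y′) ⟩
  w + (y′ + y)  ≡⟨ +-assoc w y′ y ⟨
  w + y′ + y    ≡⟨ cong (_+ y) e′ ⟨
  q′ + x′ + y   ≡⟨ +-assoc q′ x′ y ⟩
  q′ + (x′ + y) ≡⟨ cong (q′ +_) cross ⟨
  q′ + (x + y′) ∎)
  where open ≡-Reasoning

offsets-shorter : ∀ {q p x y} → q + x ≡ p + y → y < x → q < p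
offsets-shorter e y<x = ≰⇒> λ p≤q → <-irrefl (sym e) (+-mono-≤-< p≤q y<x)

cubic-threshold : ∀ n → n * suc (n * n + n * n) ≤ 3 * n ^ 3
cubic-threshold zero        = z≤n
cubic-threshold n@(suc _) = begin
  n * (1 + (n * n + n * n))     ≤⟨ *-monoʳ-≤ n (+-monoˡ-≤ (n * n + n * n) (s≤s z≤n)) ⟩
  n * (n * n + (n * n + n * n)) ≡⟨ expand n ⟩
  3 * n ^ 3                     ∎
  where
  open ≤-Reasoning
  expand : ∀ n → n * (n * n + (n * n + n * n)) ≡ 3 * (n * (n * (n * 1)))
  expand = solve-∀

descend : {A : Set} (P : A → Set) (size : A → ℕ) (bound : ℕ) →
          (∀ x → P x → bound < size x → Σ A λ y → P y × size y < size x) →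
          ∀ x → P x → Σ A λ y → P y × size y ≤ bound
descend {A} P size bound shrink x Px = go x Px (<-wellFounded (size x))
  where
  go : ∀ x → P x → Acc _<_ (size x) → Σ A λ y → P y × size y ≤ bound
  go x Px (acc smaller) with size x ≤? bound
  ... | yes small = x , Px , small
  ... | no large  = let (y , Py , y<x) = shrink x Px (≰⇒> large) in go y Py (smaller y<x)

module _ {n : ℕ} {E : Digraph n} where

  vertexAt : ∀ {s t} → Walk E s t → ℕ → Fin n
  vertexAt {s} []         _       = s
  vertexAt {s} (step _ _) zero    = s
  vertexAt     (step _ p) (suc i) = vertexAt p i

  take : ∀ {s t} (p : Walk E s t) i → Walk E s (vertexAt p i)
  take []         _       = []
  take (step _ _) zero    = []
  take (step e p) (suc i) = step e (take p i)

  drop : ∀ {s t} (p : Walk E s t) i → Walk E (vertexAt p i) t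
  drop []         _       = []
  drop (step e p) zero    = step e p
  drop (step _ p) (suc i) = drop p i

  _++_ : ∀ {u v w} → Walk E u v → Walk E v w → Walk E u w
  []         ++ q = q
  (step e p) ++ q = step e (p ++ q)

  _++[_]_ : ∀ {u v v′ w} → Walk E u v → v ≡ v′ → Walk E v′ w → Walk E u w
  p ++[ refl ] q = p ++ q

  vertexAt-drop : ∀ {s t} (p : Walk E s t) i k → vertexAt (drop p i) k ≡ vertexAt p (i + k)
  vertexAt-drop []         _       _ = refl
  vertexAt-drop (step _ _) zero    _ = refl
  vertexAt-drop (step _ p) (suc i) k = vertexAt-drop p i k

  weight : (Fin n → Fin n → ℕ) → ∀ {s t} → Walk E s t → ℕ
  weight w []                 = 0
  weight w (step {u} {v} _ p) = w u v + weight w p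

  prefix : (Fin n → Fin n → ℕ) → ∀ {s t} → Walk E s t → ℕ → ℕ
  prefix w p i = weight w (take p i)

  weight-++ : ∀ w {u v x} (p : Walk E u v) (q : Walk E v x) →
              weight w (p ++ q) ≡ weight w p + weight w q
  weight-++ w []                 q = refl
  weight-++ w (step {u} {v} _ p) q =
    trans (cong (w u v +_) (weight-++ w p q)) (sym (+-assoc (w u v) _ _))

  weight-++[] : ∀ w {u v v′ x} (p : Walk E u v) (e : v ≡ v′) (q : Walk E v′ x) →
                weight w (p ++[ e ] q) ≡ weight w p + weight w q
  weight-++[] w p refl q = weight-++ w p q

  prefix+weight-drop : ∀ w {s t} (p : Walk E s t) i → prefix w p i + weight w (drop p i) ≡ weight w p
  prefix+weight-drop w []                 _       = refl
  prefix+weight-drop w (step _ _)         zero    = refl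
  prefix+weight-drop w (step {u} {v} _ p) (suc i) =
    trans (+-assoc (w u v) _ _) (cong (w u v +_) (prefix+weight-drop w p i))

  prefix+prefix-drop : ∀ w {s t} (p : Walk E s t) i k → prefix w p i + prefix w (drop p i) k ≡ prefix w p (i + k)
  prefix+prefix-drop w []                 _       _ = refl
  prefix+prefix-drop w (step _ _)         zero    _ = refl
  prefix+prefix-drop w (step {u} {v} _ p) (suc i) k =
    trans (+-assoc (w u v) _ _) (cong (w u v +_) (prefix+prefix-drop w p i k))

  prefix-length : ∀ w {s t} (p : Walk E s t) → prefix w p (length p) ≡ weight w p
  prefix-length w []                 = refl
  prefix-length w (step {u} {v} _ p) = cong (w u v +_) (prefix-length w p)

  one : Fin n → Fin n → ℕ
  one _ _ = 1

  weight-one : ∀ {s t} (p : Walk E s t) → weight one p ≡ length p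
  weight-one []         = refl
  weight-one (step _ p) = cong suc (weight-one p)

  prefix-one : ∀ {s t} (p : Walk E s t) {i} → i ≤ length p → prefix one p i ≡ i
  prefix-one []         z≤n       = refl
  prefix-one (step _ _) z≤n       = refl
  prefix-one (step _ p) (s≤s i≤) = cong suc (prefix-one p i≤)

  prefix-counter : ∀ {w} → (∀ u v → w u v ≤ 1) → ∀ {s t} (p : Walk E s t) → StepCounter (prefix w p)
  prefix-counter {w} w≤1 p = record { start = start p ; mono = mono p ; unit = unit p }
    where
    start : ∀ {s t} (p : Walk E s t) → prefix w p 0 ≡ 0
    start []         = refl
    start (step _ _) = refl
    mono : ∀ {s t} (p : Walk E s t) i → prefix w p i ≤ prefix w p (suc i)
    mono []                 _       = z≤n
    mono (step _ _)         zero    = z≤n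
    mono (step {u} {v} _ p) (suc i) = +-monoʳ-≤ (w u v) (mono p i)
    unit : ∀ {s t} (p : Walk E s t) i → prefix w p (suc i) ≤ suc (prefix w p i)
    unit []                 _       = z≤n
    unit (step {u} {v} _ p) zero    = ≤-trans (+-monoʳ-≤ (w u v) (≤-reflexive (start p)))
                                              (≤-trans (≤-reflexive (+-identityʳ (w u v))) (w≤1 u v))
    unit (step {u} {v} _ p) (suc i) =
      ≤-trans (+-monoʳ-≤ (w u v) (unit p i)) (≤-reflexive (+-suc (w u v) _))

  forward backward : Fin n → Fin n → ℕ
  forward  u v = isForward (E u v) (E v u)
  backward u v = isForward (E v u) (E u v)

  isForward≤1 : ∀ x y → isForward x y ≤ 1
  isForward≤1 true  false = ≤-refl
  isForward≤1 true  true  = z≤n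
  isForward≤1 false _     = z≤n

  weight-forward : ∀ {s t} (p : Walk E s t) → weight forward p ≡ forwardCount p
  weight-forward []         = refl
  weight-forward (step _ p) = cong (_ +_) (weight-forward p)

  weight-backward : ∀ {s t} (p : Walk E s t) → weight backward p ≡ backwardCount p
  weight-backward []         = refl
  weight-backward (step _ p) = cong (_ +_) (weight-backward p)

  module _ {s t : Fin n} (p : Walk E s t) {L : ℕ} {f g : ℕ → ℕ}
           (c : Shortcut L (vertexAt p) f g) where
    open Shortcut c

    middle-end : vertexAt (drop p a′) (b′ ∸ a′) ≡ vertexAt p b
    middle-end = trans (vertexAt-drop p a′ (b′ ∸ a′))
                       (trans (cong (vertexAt p) (m+[n∸m]≡n a′≤b′)) loop₂)

    shortcut : Walk E s t
    shortcut = take p a ++[ loop₁ ] (take (drop p a′) (b′ ∸ a′) ++[ middle-end ] drop p b)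

    weight-shortcut : ∀ w → weight w shortcut + (prefix w p a′ + prefix w p b) ≡
                            weight w p + (prefix w p a + prefix w p b′)
    weight-shortcut w = begin
      weight w shortcut + (P a′ + P b)   ≡⟨ cong (_+ (P a′ + P b)) split ⟩
      P a + (M + D) + (P a′ + P b)       ≡⟨ regroup (P a) M D (P a′) (P b) ⟩
      (P b + D) + (P a + (P a′ + M))     ≡⟨ cong₂ (λ x y → x + (P a + y))
                                                  (prefix+weight-drop w p b) middle ⟩
      weight w p + (P a + P b′)          ∎
      where
      open ≡-Reasoning
      P = prefix w p
      M = prefix w (drop p a′) (b′ ∸ a′)
      D = weight w (drop p b)
      split : weight w shortcut ≡ P a + (M + D)
      split = trans (weight-++[] w (take p a) loop₁ _)
                    (cong (P a +_) (weight-++[] w (take (drop p a′) (b′ ∸ a′)) middle-end (drop p b)))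
      middle : P a′ + M ≡ P b′
      middle = trans (prefix+prefix-drop w p a′ (b′ ∸ a′)) (cong P (m+[n∸m]≡n a′≤b′))
      regroup : ∀ x m d y z → x + (m + d) + (y + z) ≡ (z + d) + (x + (y + m))
      regroup = solve-∀

  shorten : ∀ {s t} (p : Walk E s t) → Balanced p →
            Shortcut (length p) (vertexAt p) (prefix forward p) (prefix backward p) →
            Σ (Walk E s t) λ q → Balanced q × length q < length p
  shorten p balanced c = shortcut p c , shortcut-balanced , shortcut-shorter
    where
    open Shortcut c
    q = shortcut p c
    shortcut-balanced : Balanced q
    shortcut-balanced = begin
      forwardCount q     ≡⟨ weight-forward q ⟨
      weight forward q   ≡⟨ offsets-cancel (trans (weight-forward p) (trans balanced (sym (weight-backward p))))
                              (weight-shortcut p c forward) (weight-shortcut p c backward) cancels ⟩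
      weight backward q  ≡⟨ weight-backward q ⟩
      backwardCount q    ∎
      where open ≡-Reasoning
    b′≤L = ≤-trans b′≤b b≤L
    a′≤L = ≤-trans a′≤b′ b′≤L
    a≤L = ≤-trans (<⇒≤ a<a′) a′≤L
    removed : prefix one p a + prefix one p b′ < prefix one p a′ + prefix one p b
    removed = begin-strict
      prefix one p a + prefix one p b′ ≡⟨ cong₂ _+_ (prefix-one p a≤L) (prefix-one p b′≤L) ⟩
      a + b′                           <⟨ +-mono-<-≤ a<a′ b′≤b ⟩
      a′ + b                           ≡⟨ cong₂ _+_ (prefix-one p a′≤L) (prefix-one p b≤L) ⟨
      prefix one p a′ + prefix one p b ∎
      where open ≤-Reasoning
    shortcut-shorter : length q < length p
    shortcut-shorter = subst₂ _<_ (weight-one q) (weight-one p)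
                         (offsets-shorter (weight-shortcut p c one) removed)

  shorten-long : ∀ {s t} (p : Walk E s t) → Balanced p → 3 * n ^ 3 < length p →
                 Σ (Walk E s t) λ q → Balanced q × length q < length p
  shorten-long p balanced long = shorten p balanced (shortcut-exists (length p) (vertexAt p)
    (prefix-counter (λ u v → isForward≤1 (E u v) (E v u)) p)
    (prefix-counter (λ u v → isForward≤1 (E v u) (E u v)) p)
    ends-balanced
    (≤-trans (cubic-threshold n) (<⇒≤ long)))
    where
    ends-balanced : prefix forward p (length p) ≡ prefix backward p (length p)
    ends-balanced = begin
      prefix forward p (length p)  ≡⟨ prefix-length forward p ⟩
      weight forward p             ≡⟨ weight-forward p ⟩
      forwardCount p               ≡⟨ balanced ⟩
      backwardCount p              ≡⟨ weight-backward p ⟨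
      weight backward p            ≡⟨ prefix-length backward p ⟨
      prefix backward p (length p) ∎
      where open ≡-Reasoning

theorem2 : Σ ℕ (λ C → 0 < C × ((n : ℕ) → (E : Digraph n) → (s t : Fin n) → (P : Walk E s t) → Balanced P → Σ (Walk E s t) (λ Q → Balanced Q × length Q ≤ C * n ^ 3)))
theorem2 = 3 , s≤s z≤n , λ n E s t → descend Balanced length (3 * n ^ 3) shorten-long
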